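{- Every polynomial endofunctor on $\mathbf{Set}$ is pitched-continuous.
   Context: The polynomial endofunctors on $\mathbf{Set}$ form the smallest class of functors containing the constant functor $\Delta_1$ at a one-element set and the identity functor, and closed under set-indexed (pointwise) products $\prod_{i\in I}F_i$ and coproducts $\coprod_{i\in I}F_i$. A pitched diagram is a commutative diagram $D\colon\mathbf{D}\to\mathbf{Set}$ containing a central $\omega^{op}$-chain $\{\alpha_i\colon A_{i+1}\to A_i\}_{i\in\mathbb{N}}$ in $\mathbf{D}$, meaning every object $B$ of $\mathbf{D}$ has an arrow $e_B\colon B\to A_i$ for some $i$ with $D(e_B)$ injective. A functor is pitched-continuous if it preserves limits of pitched diagrams (sends limit cones of pitched diagrams to limit cones). -}

module Defs where

open import Level using (0ℓ)
open import Data.Nat using (ℕ; suc)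
open import Data.Unit using (⊤)
open import Data.Product using (Σ; _×_; _,_; proj₁; proj₂)
open import Function using (_∘′_)
open import Function.Definitions using (Injective)
open import Relation.Binary.PropositionalEquality using (_≡_)

record Category : Set₁ where
  infixr 9 _∘_
  field
    Obj    : Set
    Hom    : Obj → Obj → Set
    id     : ∀ {a} → Hom a a
    _∘_    : ∀ {a b c} → Hom b c → Hom a b → Hom a c
    idˡ    : ∀ {a b} (f : Hom a b) → id ∘ f ≡ f
    idʳ    : ∀ {a b} (f : Hom a b) → f ∘ id ≡ f
    assoc  : ∀ {a b c d} (h : Hom c d) (g : Hom b c) (f : Hom a b) →
             (h ∘ g) ∘ f ≡ h ∘ (g ∘ f)

record PreDiagram (C : Category) : Set₁ where
  open Category C
  field
    F₀ : Obj → Set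
    F₁ : ∀ {a b} → Hom a b → F₀ a → F₀ b

record Diagram (C : Category) : Set₁ where
  open Category C
  field
    pre  : PreDiagram C
  open PreDiagram pre public
  field
    F-id : ∀ {a} (x : F₀ a) → F₁ (id {a}) x ≡ x
    F-∘  : ∀ {a b c} (g : Hom b c) (f : Hom a b) (x : F₀ a) →
           F₁ (g ∘ f) x ≡ F₁ g (F₁ f x)

record ConeData {C : Category} (D : PreDiagram C) : Set₁ where
  open Category C
  open PreDiagram D
  field
    Apex : Set
    leg  : ∀ b → Apex → F₀ b

IsCone : {C : Category} {D : PreDiagram C} → ConeData D → Set
IsCone {C} {D} c =
  ∀ {a b} (f : Category.Hom C a b) (x : ConeData.Apex c) →
  PreDiagram.F₁ D f (ConeData.leg c a x) ≡ ConeData.leg c b x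

IsLimit : {C : Category} {D : PreDiagram C} → ConeData D → Set₁
IsLimit {C} {D} c =
  IsCone c ×
  ((c' : ConeData D) → IsCone c' →
   Σ (ConeData.Apex c' → ConeData.Apex c) λ m →
     ((b : Category.Obj C) (x : ConeData.Apex c') →
        ConeData.leg c b (m x) ≡ ConeData.leg c' b x)
     × ((m' : ConeData.Apex c' → ConeData.Apex c) →
        ((b : Category.Obj C) (x : ConeData.Apex c') →
           ConeData.leg c b (m' x) ≡ ConeData.leg c' b x) →
        (x : ConeData.Apex c') → m' x ≡ m x))

record Pitched {C : Category} (D : Diagram C) : Set where
  open Category C
  open Diagram D
  field
    A : ℕ → Obj
    α : ∀ i → Hom (A (suc i)) (A i)
    e : ∀ B → Σ ℕ λ i → Σ (Hom B (A i)) λ f → Injective _≡_ _≡_ (F₁ f)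

record EndoData : Set₁ where
  field
    Fo : Set → Set
    Fm : ∀ {X Y : Set} → (X → Y) → Fo X → Fo Y

-- F ∘ D (only the data is needed to speak about cones and limits).
_∘D_ : {C : Category} → EndoData → Diagram C → PreDiagram C
F ∘D D = record { F₀ = λ b → EndoData.Fo F (Diagram.F₀ D b)
                ; F₁ = λ f → EndoData.Fm F (Diagram.F₁ D f) }

mapCone : {C : Category} (F : EndoData) {D : Diagram C} →
          ConeData (Diagram.pre D) → ConeData (F ∘D D)
mapCone F c = record
  { Apex = EndoData.Fo F (ConeData.Apex c)
  ; leg  = λ b → EndoData.Fm F (ConeData.leg c b) }

PitchedContinuous : EndoData → Set₁
PitchedContinuous F =
  (C : Category) (D : Diagram C) → Pitched D →
  (c : ConeData (Diagram.pre D)) → IsLimit c → IsLimit (mapCone F {D} c)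

data Poly : Set₁ where
  Δ₁     : Poly
  Id     : Poly
  ∏[_]_  : (I : Set) → (I → Poly) → Poly
  ∐[_]_  : (I : Set) → (I → Poly) → Poly

⟦_⟧ : Poly → Set → Set
⟦ Δ₁ ⟧ X = ⊤
⟦ Id ⟧ X = X
⟦ ∏[ I ] F ⟧ X = (i : I) → ⟦ F i ⟧ X
⟦ ∐[ I ] F ⟧ X = Σ I λ i → ⟦ F i ⟧ X

⟦_⟧₁ : (P : Poly) {X Y : Set} → (X → Y) → ⟦ P ⟧ X → ⟦ P ⟧ Y
⟦ Δ₁ ⟧₁ f x = x
⟦ Id ⟧₁ f x = f x
⟦ ∏[ I ] F ⟧₁ f g = λ i → ⟦ F i ⟧₁ f (g i)
⟦ ∐[ I ] F ⟧₁ f (i , x) = i , ⟦ F i ⟧₁ f x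

polyEndo : Poly → EndoData
polyEndo P = record { Fo = ⟦ P ⟧ ; Fm = ⟦ P ⟧₁ }

-- A cone in Set is a limit iff its apex is in bijection with the compatible
-- families of the diagram. Products commute with this description of limits
-- outright, and a coproduct does whenever the shape is connected and nonempty:
-- the summand index of a compatible family is then constant, so the family lies
-- in a single summand. A pitched diagram is connected through its central chain,
-- so every polynomial functor, being built from Δ₁ and Id by products and
-- coproducts, preserves its limits.
module Submission where

open import Defs
open import Level using (0ℓ)
open import Axiom.Extensionality.Propositional using (Extensionality)
open import Data.Nat using (zero; suc)
open import Data.Unit using (⊤; tt)
open import Data.Product using (Σ; _,_; proj₁; proj₂)
open import Data.Product.Properties using (,-injectiveˡ; ,-injectiveʳ-UIP)
open import Axiom.UniquenessOfIdentityProofs.WithK using (uip)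
open import Relation.Binary.PropositionalEquality
  using (_≡_; refl; sym; trans; cong; cong-app)

module _ {I : Set} where

  fibre : {X : I → Set} {i : I} (z : Σ I X) → proj₁ z ≡ i → X i
  fibre (_ , x) refl = x

  fibre-η : {X : I → Set} {i : I} (z : Σ I X) (p : proj₁ z ≡ i) → (i , fibre z p) ≡ z
  fibre-η (_ , _) refl = refl

  fibre-natural : {X Y : I → Set} {i : I} (φ : ∀ j → X j → Y j) (z : Σ I X) (w : Σ I Y) →
                  (proj₁ z , φ (proj₁ z) (proj₂ z)) ≡ w →
                  (p : proj₁ z ≡ i) (q : proj₁ w ≡ i) → φ i (fibre z p) ≡ fibre w q
  fibre-natural φ (_ , _) _ refl refl refl = refl

module _ {C : Category} where
  open Category C

  Compatible : (E : PreDiagram C) → (∀ b → PreDiagram.F₀ E b) → Set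
  Compatible E s = ∀ {a b} (f : Hom a b) → PreDiagram.F₁ E f (s a) ≡ s b

  record IsSetLimit {E : PreDiagram C} (c : ConeData E) : Set where
    open ConeData c
    field
      isCone   : IsCone c
      glue     : (s : ∀ b → PreDiagram.F₀ E b) → Compatible E s → Apex
      leg-glue : (s : ∀ b → PreDiagram.F₀ E b) (cs : Compatible E s) →
                 ∀ b → leg b (glue s cs) ≡ s b
      separate : ∀ x y → (∀ b → leg b x ≡ leg b y) → x ≡ y

  ⊤-cone : {E : PreDiagram C} → (∀ b → PreDiagram.F₀ E b) → ConeData E
  ⊤-cone s = record { Apex = ⊤ ; leg = λ b _ → s b }

  module _ {E : PreDiagram C} {c : ConeData E} where
    open ConeData c

    isLimit⇒isSetLimit : IsLimit c → IsSetLimit c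
    isLimit⇒isSetLimit (cone , universal) = record
      { isCone = cone ; glue = glue ; leg-glue = leg-glue ; separate = separate }
      where
      glue : (s : ∀ b → PreDiagram.F₀ E b) → Compatible E s → Apex
      glue s cs = proj₁ (universal (⊤-cone s) (λ f _ → cs f)) tt

      leg-glue : (s : ∀ b → PreDiagram.F₀ E b) (cs : Compatible E s) → ∀ b → leg b (glue s cs) ≡ s b
      leg-glue s cs b = proj₁ (proj₂ (universal (⊤-cone s) (λ f _ → cs f))) b tt

      glue-unique : (s : ∀ b → PreDiagram.F₀ E b) (cs : Compatible E s) (x : Apex) →
                    (∀ b → leg b x ≡ s b) → x ≡ glue s cs
      glue-unique s cs x legs =
        proj₂ (proj₂ (universal (⊤-cone s) (λ f _ → cs f))) (λ _ → x) (λ b _ → legs b) tt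

      separate : ∀ x y → (∀ b → leg b x ≡ leg b y) → x ≡ y
      separate x y legs≡ =
        trans (glue-unique (λ b → leg b x) (λ f → cone f x) x (λ _ → refl))
              (sym (glue-unique (λ b → leg b x) (λ f → cone f x) y (λ b → sym (legs≡ b))))

    isSetLimit⇒isLimit : IsSetLimit c → IsLimit c
    isSetLimit⇒isLimit lim = isCone , λ c' cone' →
        through c' cone'
      , legs-through c' cone'
      , λ m legsₘ x → separate _ _ λ b → trans (legsₘ b x) (sym (legs-through c' cone' b x))
      where
      open IsSetLimit lim

      through : (c' : ConeData E) → IsCone c' → ConeData.Apex c' → Apex
      through c' cone' x = glue (λ b → ConeData.leg c' b x) (λ f → cone' f x)

      legs-through : (c' : ConeData E) (cone' : IsCone c') →
                     ∀ b x → leg b (through c' cone' x) ≡ ConeData.leg c' b x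
      legs-through c' cone' b x = leg-glue (λ b → ConeData.leg c' b x) (λ f → cone' f x) b

  record Connected : Set₁ where
    field
      base    : Obj
      linked  : {I : Set} (k : Obj → I) → (∀ {a b} → Hom a b → k a ≡ k b) →
                ∀ b → k b ≡ k base

  pitched⇒connected : {D : Diagram C} → Pitched D → Connected
  pitched⇒connected pit = record { base = A 0 ; linked = linked }
    where
    open Pitched pit

    linked : {I : Set} (k : Obj → I) → (∀ {a b} → Hom a b → k a ≡ k b) →
             ∀ b → k b ≡ k (A 0)
    linked k k-invariant b = trans (k-invariant (proj₁ (proj₂ (e b)))) (down (proj₁ (e b)))
      where
      down : ∀ i → k (A i) ≡ k (A 0)
      down zero    = refl
      down (suc i) = trans (k-invariant (α i)) (down i)

  module _ {I : Set} (E : I → PreDiagram C) where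
    open PreDiagram

    ∏D : PreDiagram C
    ∏D = record { F₀ = λ b → (i : I) → F₀ (E i) b ; F₁ = λ f s i → F₁ (E i) f (s i) }

    ∐D : PreDiagram C
    ∐D = record { F₀ = λ b → Σ I λ i → F₀ (E i) b
                ; F₁ = λ f s → proj₁ s , F₁ (E (proj₁ s)) f (proj₂ s) }

    module _ (c : ∀ i → ConeData (E i)) where
      open ConeData

      ∏C : ConeData ∏D
      ∏C = record { Apex = (i : I) → Apex (c i) ; leg = λ b x i → leg (c i) b (x i) }

      ∐C : ConeData ∐D
      ∐C = record { Apex = Σ I λ i → Apex (c i)
                  ; leg  = λ b x → proj₁ x , leg (c (proj₁ x)) b (proj₂ x) }

      ∏-isSetLimit : Extensionality 0ℓ 0ℓ → (∀ i → IsSetLimit (c i)) → IsSetLimit ∏C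
      ∏-isSetLimit ext lim = record
        { isCone   = λ f x → ext λ i → isCone (lim i) f (x i)
        ; glue     = λ s cs i → glue (lim i) (λ b → s b i) (λ f → cong-app (cs f) i)
        ; leg-glue = λ s cs b → ext λ i →
                       leg-glue (lim i) (λ b → s b i) (λ f → cong-app (cs f) i) b
        ; separate = λ x y legs≡ → ext λ i →
                       separate (lim i) (x i) (y i) λ b → cong-app (legs≡ b) i
        }
        where open IsSetLimit

      ∐-isSetLimit : Connected → (∀ i → IsSetLimit (c i)) → IsSetLimit ∐C
      ∐-isSetLimit connected lim = record
        { isCone   = λ f x → cong (proj₁ x ,_) (isCone (lim (proj₁ x)) f (proj₂ x))
        ; glue     = λ s cs → index s cs , glue (lim (index s cs)) (restrict s cs) (restrict-compatible s cs)
        ; leg-glue = λ s cs b →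
                       trans (cong (index s cs ,_)
                                   (leg-glue (lim (index s cs)) (restrict s cs) (restrict-compatible s cs) b))
                             (fibre-η (s b) (index-constant s cs b))
        ; separate = separate∐
        }
        where
        open IsSetLimit
        open Connected connected

        module _ (s : ∀ b → F₀ ∐D b) (cs : Compatible ∐D s) where
          index : I
          index = proj₁ (s base)

          index-constant : ∀ b → proj₁ (s b) ≡ index
          index-constant = linked (λ b → proj₁ (s b)) (λ f → cong proj₁ (cs f))

          restrict : ∀ b → F₀ (E index) b
          restrict b = fibre (s b) (index-constant b)

          restrict-compatible : Compatible (E index) restrict
          restrict-compatible {a} {b} f =
            fibre-natural (λ i → F₁ (E i) f) (s a) (s b) (cs f) (index-constant a) (index-constant b)

        separate∐ : ∀ x y → (∀ b → leg ∐C b x ≡ leg ∐C b y) → x ≡ y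
        separate∐ (i , u) (j , v) legs≡ with ,-injectiveˡ (legs≡ base)
        ... | refl = cong (i ,_) (separate (lim i) u v λ b → ,-injectiveʳ-UIP uip (legs≡ b))

module _ {C : Category} {D : Diagram C} {c : ConeData (Diagram.pre D)} where

  ⟦⟧-isSetLimit : Extensionality 0ℓ 0ℓ → Connected {C} → IsSetLimit c →
                  (P : Poly) → IsSetLimit (mapCone (polyEndo P) {D} c)
  ⟦⟧-isSetLimit ext connected lim Δ₁ = record
    { isCone   = λ _ _ → refl
    ; glue     = λ _ _ → tt
    ; leg-glue = λ _ _ _ → refl
    ; separate = λ _ _ _ → refl
    }
  ⟦⟧-isSetLimit ext connected lim Id = lim
  ⟦⟧-isSetLimit ext connected lim (∏[ I ] G) =
    ∏-isSetLimit _ _ ext λ i → ⟦⟧-isSetLimit ext connected lim (G i)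
  ⟦⟧-isSetLimit ext connected lim (∐[ I ] G) =
    ∐-isSetLimit _ _ connected λ i → ⟦⟧-isSetLimit ext connected lim (G i)

lemma4 : Extensionality 0ℓ 0ℓ → (P : Poly) → PitchedContinuous (polyEndo P)
lemma4 ext P C D pitched c lim =
  isSetLimit⇒isLimit
    (⟦⟧-isSetLimit {D = D} ext (pitched⇒connected pitched) (isLimit⇒isSetLimit {c = c} lim) P)
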